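{- Let $n\ge 1$ and $1\le k\le n$ be integers and let $N_{n,k,i}$ denote the number of binary sequences of length $n$ with exactly $i$ successes in which every run of consecutive failures has length strictly less than $k$. Then \[ N_{n,k,i}=\binom{n}{i}-(i+1)\binom{n-k}{i}\quad\text{for all integers } i\in\{n-2k+1,\dots,n-k\},\ i\ge 0, \] and \[ N_{n,k,i}=\binom{n}{i}-(i+1)\binom{n-k}{i}+\binom{i+1}{2}\binom{n-2k}{i}\quad\text{for all integers } i\in\{n-3k+1,\dots,n-2k\},\ i\ge 0. \]
   Context: Binomial coefficients $\binom{a}{b}$ with $a\ge 0$ vanish when $b>a$. $N_{n,k,i}$ are the coefficients of the reliability polynomial $R(k,n;p)=\sum_{i}N_{n,k,i}p^i(1-p)^{n-i}$ of a consecutive-$k$-out-of-$n$:$F$ system. -}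

module Defs where

open import Data.Nat using (ℕ; zero; suc; _+_; _<_; _≡ᵇ_; _<ᵇ_)
open import Data.Bool using (Bool; true; false; _∧_)
open import Data.List using (List; []; _∷_; map; _++_; length; filter)
open import Data.Vec using (Vec; []; _∷_)
open import Relation.Nullary.Decidable using (Dec; _×-dec_)
open import Data.Product using (_×_)
open import Relation.Binary.PropositionalEquality using (_≡_)
import Data.Nat.Properties as ℕP

-- A binary sequence of length n: true = success, false = failure.

allSeqs : (n : ℕ) → List (Vec Bool n)
allSeqs zero = [] ∷ []
allSeqs (suc n) = map (true ∷_) (allSeqs n) ++ map (false ∷_) (allSeqs n)

successes : {n : ℕ} → Vec Bool n → ℕ
successes [] = 0
successes (true ∷ v) = suc (successes v)
successes (false ∷ v) = successes v

maxFailRunAux : {n : ℕ} → ℕ → ℕ → Vec Bool n → ℕ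
maxFailRunAux r m [] = Data.Nat._⊔_ r m
maxFailRunAux r m (true ∷ v) = maxFailRunAux 0 (Data.Nat._⊔_ r m) v
maxFailRunAux r m (false ∷ v) = maxFailRunAux (suc r) m v

maxFailRun : {n : ℕ} → Vec Bool n → ℕ
maxFailRun v = maxFailRunAux 0 0 v

Good : (n k i : ℕ) → Vec Bool n → Set
Good n k i v = (successes v ≡ i) × (maxFailRun v < k)

good? : (n k i : ℕ) → (v : Vec Bool n) → Dec (Good n k i v)
good? n k i v = (successes v ℕP.≟ i) ×-dec (maxFailRun v ℕP.<? k)

N : (n k i : ℕ) → ℕ
N n k i = length (filter (good? n k i) (allSeqs n))

-- Let F s n i (boundedRuns) count the length-n sequences with i successes
-- whose leading failure run is shorter than s and whose other failure runs are
-- shorter than k, so that N n k i = F k n i.  Reading off the first symbol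
-- gives F (s+1) (n+1) (i+1) = F k n i + F s n (i+1).  Inclusion–exclusion over
-- the forbidden runs suggests
--   F s n i + C(n−s,i) + i C(n−k,i) = C(n,i) + i C(n−s−k,i) + C(i,2) C(n−2k,i)
-- as long as n − i < s + 2k, i.e. no three forbidden runs fit, and this follows
-- by induction on n from the recurrence and Pascal's rule.  For s = k it is the
-- theorem, with C(n−2k,i) = 0 in the first range.
module Submission where

open import Defs
open import Data.Nat using (ℕ; zero; suc; _≤_; _<_; _∸_; _⊔_; z≤n; s≤s)
import Data.Nat as ℕ
open import Data.Nat.Properties
open import Data.Nat.Combinatorics using (_C_; nCk+nC[k+1]≡[n+1]C[k+1]; k>n⇒nCk≡0; nC1≡n)
open import Data.Nat.Tactic.RingSolver using (solve-∀)
open import Data.Integer using (+_; _+_; _-_; _⊖_)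
import Data.Integer.Properties as ℤ
open import Data.Integer.Tactic.RingSolver as ℤ-Solver using ()
open import Data.Bool using (Bool; true; false)
open import Data.Vec using (Vec; []; _∷_)
open import Data.List using (List; []; _∷_; map; _++_; length; filter)
import Data.List.Properties as List
open import Data.List.Relation.Unary.All using (universal)
open import Data.Product using (_×_; _,_)
open import Relation.Nullary using (¬_; yes; no; does)
open import Relation.Nullary.Decidable using (_×-dec_)
open import Relation.Unary using (Pred; Decidable)
open import Relation.Binary.PropositionalEquality
  using (_≡_; refl; sym; trans; cong; cong₂; subst; module ≡-Reasoning)
open import Level using (0ℓ)

open ≡-Reasoning

module _ {A : Set} {P : Pred A 0ℓ} (P? : Decidable P) where

  length-filter-++ : (xs ys : List A) →
    length (filter P? (xs ++ ys)) ≡ length (filter P? xs) ℕ.+ length (filter P? ys)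
  length-filter-++ xs ys =
    trans (cong length (List.filter-++ P? xs ys)) (List.length-++ (filter P? xs))

  length-filter-none : (∀ x → ¬ P x) → (xs : List A) → length (filter P? xs) ≡ 0
  length-filter-none ¬P xs = cong length (List.filter-none P? (universal ¬P xs))

length-filter-map : {A B : Set} {P : Pred B 0ℓ} (P? : Decidable P) (f : A → B) (xs : List A) →
  length (filter P? (map f xs)) ≡ length (filter (λ x → P? (f x)) xs)
length-filter-map P? f [] = refl
length-filter-map P? f (x ∷ xs) with does (P? (f x))
... | true  = cong suc (length-filter-map P? f xs)
... | false = length-filter-map P? f xs

maxFailRunAux-≥ : ∀ {n} r m (v : Vec Bool n) → r ⊔ m ≤ maxFailRunAux r m v
maxFailRunAux-≥ r m []          = ≤-refl
maxFailRunAux-≥ r m (true ∷ v)  = maxFailRunAux-≥ 0 (r ⊔ m) v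
maxFailRunAux-≥ r m (false ∷ v) =
  ≤-trans (⊔-monoˡ-≤ m (n≤1+n r)) (maxFailRunAux-≥ (suc r) m v)

-- binom∸ n s i is C(n − s, i) read with an integer top, hence 0 when n < s;
-- this differs from (n ∸ s) C i, which is 1 for i = 0.
binom∸ : ℕ → ℕ → ℕ → ℕ
binom∸ n       zero    i = n C i
binom∸ zero    (suc s) i = 0
binom∸ (suc n) (suc s) i = binom∸ n s i

binom∸-zero-suc : ∀ s i → binom∸ 0 s (suc i) ≡ 0
binom∸-zero-suc zero    i = refl
binom∸-zero-suc (suc s) i = refl

binom∸-pascal : ∀ n s i → binom∸ (suc n) s (suc i) ≡ binom∸ n s (suc i) ℕ.+ binom∸ n s i
binom∸-pascal n       zero    i =
  trans (sym (nCk+nC[k+1]≡[n+1]C[k+1] n i)) (+-comm (n C i) (n C suc i))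
binom∸-pascal zero    (suc s) i = binom∸-zero-suc s i
binom∸-pascal (suc n) (suc s) i = binom∸-pascal n s i

binom∸-vanish : ∀ n s i → n < s ℕ.+ i → binom∸ n s i ≡ 0
binom∸-vanish n       zero    i n<i            = k>n⇒nCk≡0 n<i
binom∸-vanish zero    (suc s) i _              = refl
binom∸-vanish (suc n) (suc s) i (s≤s n<s+i) = binom∸-vanish n s i n<s+i

binom∸-≤ : ∀ n s i → s ≤ n → binom∸ n s i ≡ (n ∸ s) C i
binom∸-≤ n       zero    i _         = refl
binom∸-≤ (suc n) (suc s) i (s≤s s≤n) = binom∸-≤ n s i s≤n

suc-C-2 : ∀ j → suc j C 2 ≡ j C 2 ℕ.+ j
suc-C-2 j = begin
  suc j C 2        ≡⟨ nCk+nC[k+1]≡[n+1]C[k+1] j 1 ⟨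
  j C 1 ℕ.+ j C 2  ≡⟨ cong (ℕ._+ j C 2) (nC1≡n j) ⟩
  j ℕ.+ j C 2      ≡⟨ +-comm j (j C 2) ⟩
  j C 2 ℕ.+ j      ∎

module _ (k : ℕ) where

  -- Successes i, and all failure runs shorter than k when the scan starts
  -- inside a failure run of length r with longest run m seen so far.
  GoodFrom : (r m i : ℕ) {n : ℕ} → Vec Bool n → Set
  GoodFrom r m i v = (successes v ≡ i) × (maxFailRunAux r m v < k)

  goodFrom? : (r m i : ℕ) {n : ℕ} → Decidable (GoodFrom r m i {n})
  goodFrom? r m i v = (successes v ≟ i) ×-dec (maxFailRunAux r m v <? k)

  countFrom : (n r m i : ℕ) → ℕ
  countFrom n r m i = length (filter (goodFrom? r m i) (allSeqs n))

  boundedRuns : ℕ → ℕ → ℕ → ℕ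
  boundedRuns zero    n       i       = 0
  boundedRuns (suc s) zero    zero    = 1
  boundedRuns (suc s) zero    (suc i) = 0
  boundedRuns (suc s) (suc n) zero    = boundedRuns s n zero
  boundedRuns (suc s) (suc n) (suc i) = boundedRuns k n i ℕ.+ boundedRuns s n (suc i)

  countFrom-suc : ∀ n r m i → countFrom (suc n) r m i ≡
    length (filter (λ v → goodFrom? r m i (true ∷ v)) (allSeqs n)) ℕ.+ countFrom n (suc r) m i
  countFrom-suc n r m i = begin
    countFrom (suc n) r m i
      ≡⟨ length-filter-++ (goodFrom? r m i) (map (true ∷_) (allSeqs n)) (map (false ∷_) (allSeqs n)) ⟩
    length (filter (goodFrom? r m i) (map (true ∷_) (allSeqs n)))
      ℕ.+ length (filter (goodFrom? r m i) (map (false ∷_) (allSeqs n)))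
      ≡⟨ cong₂ ℕ._+_ (length-filter-map (goodFrom? r m i) (true ∷_) (allSeqs n))
                     (length-filter-map (goodFrom? r m i) (false ∷_) (allSeqs n)) ⟩
    length (filter (λ v → goodFrom? r m i (true ∷ v)) (allSeqs n)) ℕ.+ countFrom n (suc r) m i
      ∎

  countFrom-true-zero : ∀ n r m →
    length (filter (λ v → goodFrom? r m 0 (true ∷ v)) (allSeqs n)) ≡ 0
  countFrom-true-zero n r m =
    length-filter-none (λ v → goodFrom? r m 0 (true ∷ v)) (λ { v (() , _) }) (allSeqs n)

  countFrom-true-suc : ∀ n r m j →
    length (filter (λ v → goodFrom? r m (suc j) (true ∷ v)) (allSeqs n)) ≡ countFrom n 0 (r ⊔ m) j
  countFrom-true-suc n r m j = cong length
    (List.filter-≐ (λ v → goodFrom? r m (suc j) (true ∷ v)) (goodFrom? 0 (r ⊔ m) j)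
      ((λ { (e , b) → suc-injective e , b }) , (λ { (e , b) → cong suc e , b }))
      (allSeqs n))

  countFrom-≥ : ∀ n r m i → k ≤ r ⊔ m → countFrom n r m i ≡ 0
  countFrom-≥ n r m i k≤r⊔m = length-filter-none (goodFrom? r m i)
    (λ v (_ , run<k) → <⇒≱ run<k (≤-trans k≤r⊔m (maxFailRunAux-≥ r m v))) (allSeqs n)

  countFrom≡boundedRuns : ∀ n r m i → m < k → countFrom n r m i ≡ boundedRuns (k ∸ r) n i
  countFrom≡boundedRuns n r m i m<k with r <? k
  ... | no r≮k rewrite m≤n⇒m∸n≡0 (≮⇒≥ r≮k) =
    countFrom-≥ n r m i (≤-trans (≮⇒≥ r≮k) (m≤m⊔n r m))
  ... | yes r<k rewrite +-∸-assoc 1 r<k = unfold n i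
    where
    unfold : ∀ n i → countFrom n r m i ≡ boundedRuns (suc (k ∸ suc r)) n i
    unfold zero zero = cong length
      (List.filter-accept (goodFrom? r m 0) {x = []} {xs = []} (refl , ⊔-lub r<k m<k))
    unfold zero (suc i) = cong length
      (List.filter-reject (goodFrom? r m (suc i)) {x = []} {xs = []} (λ { (() , _) }))
    unfold (suc n) zero = trans (countFrom-suc n r m 0)
      (cong₂ ℕ._+_ (countFrom-true-zero n r m) (countFrom≡boundedRuns n (suc r) m 0 m<k))
    unfold (suc n) (suc j) = trans (countFrom-suc n r m (suc j))
      (cong₂ ℕ._+_
        (trans (countFrom-true-suc n r m j) (countFrom≡boundedRuns n 0 (r ⊔ m) j (⊔-lub r<k m<k)))
        (countFrom≡boundedRuns n (suc r) m (suc j) m<k))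

  boundedRuns-inclusion-exclusion : ∀ s n i → s ≤ k → n < i ℕ.+ (k ℕ.+ k) ℕ.+ s →
    boundedRuns s n i ℕ.+ binom∸ n s i ℕ.+ i ℕ.* binom∸ n k i
      ≡ n C i ℕ.+ i ℕ.* binom∸ n (s ℕ.+ k) i ℕ.+ (i C 2) ℕ.* binom∸ n (k ℕ.+ k) i
  boundedRuns-inclusion-exclusion zero n i _ n<i+2k = begin
    n C i ℕ.+ i ℕ.* binom∸ n k i
      ≡⟨ +-identityʳ _ ⟨
    n C i ℕ.+ i ℕ.* binom∸ n k i ℕ.+ 0
      ≡⟨ cong (n C i ℕ.+ i ℕ.* binom∸ n k i ℕ.+_) (*-zeroʳ (i C 2)) ⟨
    n C i ℕ.+ i ℕ.* binom∸ n k i ℕ.+ (i C 2) ℕ.* 0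
      ≡⟨ cong (λ y → n C i ℕ.+ i ℕ.* binom∸ n k i ℕ.+ (i C 2) ℕ.* y) (binom∸-vanish n (k ℕ.+ k) i n<2k+i) ⟨
    n C i ℕ.+ i ℕ.* binom∸ n k i ℕ.+ (i C 2) ℕ.* binom∸ n (k ℕ.+ k) i
      ∎
    where
    n<2k+i : n < k ℕ.+ k ℕ.+ i
    n<2k+i = subst (n <_) (trans (+-identityʳ _) (+-comm i (k ℕ.+ k))) n<i+2k
  boundedRuns-inclusion-exclusion (suc s) zero zero _ _ = refl
  boundedRuns-inclusion-exclusion (suc s) zero (suc i) _ _
    rewrite binom∸-zero-suc k i | binom∸-zero-suc (k ℕ.+ k) i
          | *-zeroʳ i | *-zeroʳ (suc i C 2) = refl
  boundedRuns-inclusion-exclusion (suc s) (suc n) zero s<k n<2k+s =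
    boundedRuns-inclusion-exclusion s n zero (<⇒≤ s<k)
      (≤-pred (subst (suc (suc n) ≤_) (+-suc (k ℕ.+ k) s) n<2k+s))
  boundedRuns-inclusion-exclusion (suc s) (suc n) (suc j) s<k n<j+2k+s = begin
    F₁ ℕ.+ F₂ ℕ.+ B ℕ.+ suc j ℕ.* binom∸ (suc n) k (suc j)
      ≡⟨ cong (λ x → F₁ ℕ.+ F₂ ℕ.+ B ℕ.+ suc j ℕ.* x) (binom∸-pascal n k j) ⟩
    F₁ ℕ.+ F₂ ℕ.+ B ℕ.+ suc j ℕ.* (X₁ ℕ.+ X₀)
      ≡⟨ split F₁ F₂ B X₁ X₀ j ⟩
    (F₁ ℕ.+ X₀ ℕ.+ j ℕ.* X₀) ℕ.+ (F₂ ℕ.+ B ℕ.+ suc j ℕ.* X₁)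
      ≡⟨ cong₂ ℕ._+_ ih-k ih-s ⟩
    (n C j ℕ.+ j ℕ.* Y₀ ℕ.+ (j C 2) ℕ.* Y₀) ℕ.+ (n C suc j ℕ.+ suc j ℕ.* Z ℕ.+ (suc j C 2) ℕ.* Y₁)
      ≡⟨ cong (λ t → (n C j ℕ.+ j ℕ.* Y₀ ℕ.+ (j C 2) ℕ.* Y₀) ℕ.+ (n C suc j ℕ.+ suc j ℕ.* Z ℕ.+ t ℕ.* Y₁))
              (suc-C-2 j) ⟩
    (n C j ℕ.+ j ℕ.* Y₀ ℕ.+ (j C 2) ℕ.* Y₀) ℕ.+ (n C suc j ℕ.+ suc j ℕ.* Z ℕ.+ (j C 2 ℕ.+ j) ℕ.* Y₁)
      ≡⟨ merge (n C j) (n C suc j) Y₀ Y₁ Z (j C 2) j ⟩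
    (n C j ℕ.+ n C suc j) ℕ.+ suc j ℕ.* Z ℕ.+ (j C 2 ℕ.+ j) ℕ.* (Y₁ ℕ.+ Y₀)
      ≡⟨ cong₂ (λ c t → c ℕ.+ suc j ℕ.* Z ℕ.+ t)
               (nCk+nC[k+1]≡[n+1]C[k+1] n j)
               (cong₂ ℕ._*_ (sym (suc-C-2 j)) (sym (binom∸-pascal n (k ℕ.+ k) j))) ⟩
    suc n C suc j ℕ.+ suc j ℕ.* Z ℕ.+ (suc j C 2) ℕ.* binom∸ (suc n) (k ℕ.+ k) (suc j)
      ∎
    where
    F₁ F₂ B X₀ X₁ Y₀ Y₁ Z : ℕ
    F₁ = boundedRuns k n j
    F₂ = boundedRuns s n (suc j)
    B  = binom∸ n s (suc j)
    X₀ = binom∸ n k j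
    X₁ = binom∸ n k (suc j)
    Y₀ = binom∸ n (k ℕ.+ k) j
    Y₁ = binom∸ n (k ℕ.+ k) (suc j)
    Z  = binom∸ n (s ℕ.+ k) (suc j)

    n<j+2k+1+s : n < j ℕ.+ (k ℕ.+ k) ℕ.+ suc s
    n<j+2k+1+s = ≤-pred n<j+2k+s

    ih-k : F₁ ℕ.+ X₀ ℕ.+ j ℕ.* X₀ ≡ n C j ℕ.+ j ℕ.* Y₀ ℕ.+ (j C 2) ℕ.* Y₀
    ih-k = boundedRuns-inclusion-exclusion k n j ≤-refl
      (<-≤-trans n<j+2k+1+s (+-monoʳ-≤ (j ℕ.+ (k ℕ.+ k)) s<k))

    ih-s : F₂ ℕ.+ B ℕ.+ suc j ℕ.* X₁ ≡ n C suc j ℕ.+ suc j ℕ.* Z ℕ.+ (suc j C 2) ℕ.* Y₁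
    ih-s = boundedRuns-inclusion-exclusion s n (suc j) (<⇒≤ s<k)
      (subst (n <_) (+-suc (j ℕ.+ (k ℕ.+ k)) s) n<j+2k+1+s)

    split : ∀ a b c x₁ x₀ j →
      a ℕ.+ b ℕ.+ c ℕ.+ suc j ℕ.* (x₁ ℕ.+ x₀) ≡ (a ℕ.+ x₀ ℕ.+ j ℕ.* x₀) ℕ.+ (b ℕ.+ c ℕ.+ suc j ℕ.* x₁)
    split = solve-∀

    merge : ∀ p q y₀ y₁ z t j →
      (p ℕ.+ j ℕ.* y₀ ℕ.+ t ℕ.* y₀) ℕ.+ (q ℕ.+ suc j ℕ.* z ℕ.+ (t ℕ.+ j) ℕ.* y₁)
        ≡ (p ℕ.+ q) ℕ.+ suc j ℕ.* z ℕ.+ (t ℕ.+ j) ℕ.* (y₁ ℕ.+ y₀)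
    merge = solve-∀

N≡boundedRuns : ∀ n k i → N n k i ≡ boundedRuns k k n i
N≡boundedRuns n zero    i = countFrom-≥ 0 n 0 0 i z≤n
N≡boundedRuns n (suc k) i = countFrom≡boundedRuns (suc k) n 0 0 i (s≤s z≤n)

N-inclusion-exclusion : ∀ n k i → k ≤ n → n < i ℕ.+ 3 ℕ.* k →
  N n k i ℕ.+ suc i ℕ.* ((n ∸ k) C i) ≡ n C i ℕ.+ (suc i C 2) ℕ.* binom∸ n (2 ℕ.* k) i
N-inclusion-exclusion n k i k≤n n<i+3k = begin
  N n k i ℕ.+ suc i ℕ.* ((n ∸ k) C i)
    ≡⟨ cong₂ (λ f x → f ℕ.+ suc i ℕ.* x) (N≡boundedRuns n k i) (sym (binom∸-≤ n k i k≤n)) ⟩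
  boundedRuns k k n i ℕ.+ suc i ℕ.* binom∸ n k i
    ≡⟨ +-assoc (boundedRuns k k n i) (binom∸ n k i) (i ℕ.* binom∸ n k i) ⟨
  boundedRuns k k n i ℕ.+ binom∸ n k i ℕ.+ i ℕ.* binom∸ n k i
    ≡⟨ boundedRuns-inclusion-exclusion k k n i ≤-refl (subst (n <_) (i+3k≡i+2k+k i k) n<i+3k) ⟩
  n C i ℕ.+ i ℕ.* Y ℕ.+ (i C 2) ℕ.* Y
    ≡⟨ collect (n C i) i (i C 2) Y ⟩
  n C i ℕ.+ (i C 2 ℕ.+ i) ℕ.* Y
    ≡⟨ cong₂ (λ t z → n C i ℕ.+ t ℕ.* binom∸ n z i) (suc-C-2 i) (2k≡k+k k) ⟨
  n C i ℕ.+ (suc i C 2) ℕ.* binom∸ n (2 ℕ.* k) i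
    ∎
  where
  Y : ℕ
  Y = binom∸ n (k ℕ.+ k) i

  i+3k≡i+2k+k : ∀ i k → i ℕ.+ 3 ℕ.* k ≡ i ℕ.+ (k ℕ.+ k) ℕ.+ k
  i+3k≡i+2k+k = solve-∀

  2k≡k+k : ∀ k → 2 ℕ.* k ≡ k ℕ.+ k
  2k≡k+k = solve-∀

  collect : ∀ c i t y → c ℕ.+ i ℕ.* y ℕ.+ t ℕ.* y ≡ c ℕ.+ (t ℕ.+ i) ℕ.* y
  collect = solve-∀

m+n≡o⇒+m≡+o-+n : ∀ {m n o} → m ℕ.+ n ≡ o → + m ≡ + o - + n
m+n≡o⇒+m≡+o-+n {m} {n} refl = sym (begin
  + (m ℕ.+ n) - + n   ≡⟨ ℤ.[+m]-[+n]≡m⊖n (m ℕ.+ n) n ⟩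
  (m ℕ.+ n) ⊖ n       ≡⟨ ℤ.⊖-≥ (m≤n+m n m) ⟩
  + (m ℕ.+ n ∸ n)     ≡⟨ cong +_ (m+n∸n≡m m n) ⟩
  + m                 ∎)

m+n≡o+p⇒+m≡+o-+n++p : ∀ {m n o p} → m ℕ.+ n ≡ o ℕ.+ p → + m ≡ (+ o - + n) + + p
m+n≡o+p⇒+m≡+o-+n++p {m} {n} {o} {p} eq = begin
  + m                  ≡⟨ m+n≡o⇒+m≡+o-+n eq ⟩
  + (o ℕ.+ p) - + n    ≡⟨ cong (_- + n) (ℤ.pos-+ o p) ⟩
  (+ o + + p) - + n    ≡⟨ swap (+ o) (+ p) (+ n) ⟩
  (+ o - + n) + + p    ∎
  where
  swap : ∀ a b c → (a + b) - c ≡ (a - c) + b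
  swap = ℤ-Solver.solve-∀

corollary2 : (n k : ℕ) → 1 ≤ n → 1 ≤ k → k ≤ n →
    (∀ (i : ℕ) → n ℕ.+ 1 ≤ i ℕ.+ 2 ℕ.* k → i ℕ.+ k ≤ n →
      + N n k i ≡ + (n C i) - + (suc i ℕ.* ((n ∸ k) C i)))
    ×
    (∀ (i : ℕ) → n ℕ.+ 1 ≤ i ℕ.+ 3 ℕ.* k → i ℕ.+ 2 ℕ.* k ≤ n →
      + N n k i ≡ (+ (n C i) - + (suc i ℕ.* ((n ∸ k) C i)))
                   + + ((suc i C 2) ℕ.* ((n ∸ 2 ℕ.* k) C i)))
corollary2 n k _ _ k≤n = first-range , second-range
  where
  n+1≤⇒n< : ∀ {x} → n ℕ.+ 1 ≤ x → n < x
  n+1≤⇒n< {x} = subst (_≤ x) (+-comm n 1)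

  first-range : ∀ i → n ℕ.+ 1 ≤ i ℕ.+ 2 ℕ.* k → i ℕ.+ k ≤ n →
    + N n k i ≡ + (n C i) - + (suc i ℕ.* ((n ∸ k) C i))
  first-range i n<i+2k _ = m+n≡o⇒+m≡+o-+n (begin
    N n k i ℕ.+ suc i ℕ.* ((n ∸ k) C i)
      ≡⟨ N-inclusion-exclusion n k i k≤n (<-≤-trans (n+1≤⇒n< n<i+2k) (+-monoʳ-≤ i (*-monoˡ-≤ k (n≤1+n 2)))) ⟩
    n C i ℕ.+ (suc i C 2) ℕ.* binom∸ n (2 ℕ.* k) i
      ≡⟨ cong (λ y → n C i ℕ.+ (suc i C 2) ℕ.* y) (binom∸-vanish n (2 ℕ.* k) i (subst (n <_) (+-comm i _) (n+1≤⇒n< n<i+2k))) ⟩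
    n C i ℕ.+ (suc i C 2) ℕ.* 0
      ≡⟨ trans (cong (n C i ℕ.+_) (*-zeroʳ (suc i C 2))) (+-identityʳ (n C i)) ⟩
    n C i
      ∎)

  second-range : ∀ i → n ℕ.+ 1 ≤ i ℕ.+ 3 ℕ.* k → i ℕ.+ 2 ℕ.* k ≤ n →
    + N n k i ≡ (+ (n C i) - + (suc i ℕ.* ((n ∸ k) C i)))
                 + + ((suc i C 2) ℕ.* ((n ∸ 2 ℕ.* k) C i))
  second-range i n<i+3k i+2k≤n = m+n≡o+p⇒+m≡+o-+n++p (begin
    N n k i ℕ.+ suc i ℕ.* ((n ∸ k) C i)
      ≡⟨ N-inclusion-exclusion n k i k≤n (n+1≤⇒n< n<i+3k) ⟩
    n C i ℕ.+ (suc i C 2) ℕ.* binom∸ n (2 ℕ.* k) i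
      ≡⟨ cong (λ y → n C i ℕ.+ (suc i C 2) ℕ.* y) (binom∸-≤ n (2 ℕ.* k) i (≤-trans (m≤n+m _ i) i+2k≤n)) ⟩
    n C i ℕ.+ (suc i C 2) ℕ.* ((n ∸ 2 ℕ.* k) C i)
      ∎)
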